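{- Let $\mathbf U=\langle\langle U,\approx\rangle,\preceq\rangle$ be a completely lattice $\mathbf L$-ordered set and $\langle f,g\rangle$ an extensive isotone $\mathbf L$-Galois connection on $\mathbf U$. Define $u\sim_{\langle f,g\rangle}v=(f(u)\preceq v)\wedge(v\preceq g(u))$ for $u,v\in U$. Then $\sim_{\langle f,g\rangle}$ is a complete $\mathbf L$-tolerance on $\mathbf U$ and for each $u\in U$, $u_{\sim_{\langle f,g\rangle}}=f(u)$ and $u^{\sim_{\langle f,g\rangle}}=g(u)$.
   Context: $\mathbf L=\langle L,\wedge,\vee,\otimes,\to,0,1\rangle$ is a complete residuated lattice ($\langle L,\wedge,\vee,0,1\rangle$ complete lattice, $\langle L,\otimes,1\rangle$ commutative monoid, $a\otimes b\le c$ iff $a\le b\to c$). An $\mathbf L$-set in $X$ is a map $X\to L$; $L^X$ the set of them; $S(A,B)=\bigwedge_x(A(x)\to B(x))$. An $\mathbf L$-equality is a binary $\mathbf L$-relation that is reflexive, symmetric, transitive ($R(x,y)\otimes R(y,z)\le R(x,z)$) and with $R(x,y)=1\Rightarrow x=y$. An $\mathbf L$-ordered set is $\langle\langle U,\approx\rangle,\preceq\rangle$, $\approx$ an $\mathbf L$-equality, $\preceq$ reflexive, transitive, compatible with $\approx$ ($(u\preceq v)\otimes(u\approx u')\otimes(v\approx v')\le(u'\preceq v')$), and $(u\preceq v)\wedge(v\preceq u)\le u\approx v$; $u\le v$ means $(u\preceq v)=1$. For $V\in L^U$: $\mathcal L V(v)=\bigwedge_u(V(u)\to(v\preceq u))$,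 $\mathcal U V(v)=\bigwedge_u(V(u)\to(u\preceq v))$; $\inf V$ is the unique $u$ with $\mathcal L V(u)=1=\mathcal U(\mathcal L V)(u)$, $\sup V$ the unique $u$ with $\mathcal U V(u)=1=\mathcal L(\mathcal U V)(u)$; completely lattice means these exist for all $V$. Power relation: for $R$ on $X$, $A,B\in L^X$, $(R\circ B)(x)=\bigvee_y R(x,y)\otimes B(y)$, $(A\circ R)(y)=\bigvee_x A(x)\otimes R(x,y)$, $R^+(A,B)=S(A,R\circ B)\wedge S(B,A\circ R)$. A binary $\mathbf L$-relation $R$ on $\mathbf U$ is complete if it is compatible with $\approx$ ($R(u,v)\otimes(u\approx u')\otimes(v\approx v')\le R(u',v')$) and $R^+(V_1,V_2)\le R(\inf V_1,\inf V_2)$, $R^+(V_1,V_2)\le R(\sup V_1,\sup V_2)$ for all $V_1,V_2\in L^U$. An $\mathbf L$-tolerance is a reflexive symmetric binary $\mathbf L$-relation; for an $\mathbf L$-tolerance $\sim$ and $u\in U$, $[u]_\sim(v)=u\sim v$, $u_\sim=\inf[u]_\sim$, $u^\sim=\sup[u]_\sim$. An isotone $\mathbf L$-Galois connection on $\mathbf U$ is a pair $\langle f,g\rangle$ of maps $U\to U$ with $(f(u)\preceq v)=(u\preceq g(v))$ for all $u,v$; it is extensive if $f(u)\le u$ and $g(u)\ge u$ for all $u$. -}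

module Defs where

open import Data.Product using (Σ; _×_; _,_; proj₁; proj₂)
open import Relation.Binary.PropositionalEquality using (_≡_)

record CompleteResiduatedLattice : Set₁ where
  infixr 6 _∧_ _∨_
  infixr 7 _⊗_
  infixr 5 _⇒_
  infix 4 _≤_
  field
    Carrier : Set
    _≤_ : Carrier → Carrier → Set
    ≤-refl : ∀ {a} → a ≤ a
    ≤-trans : ∀ {a b c} → a ≤ b → b ≤ c → a ≤ c
    ≤-antisym : ∀ {a b} → a ≤ b → b ≤ a → a ≡ b
    ⋀ : {I : Set} → (I → Carrier) → Carrier
    ⋀-lower : ∀ {I} (h : I → Carrier) (i : I) → ⋀ h ≤ h i
    ⋀-greatest : ∀ {I} (h : I → Carrier) {a} → (∀ i → a ≤ h i) → a ≤ ⋀ h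
    ⋁ : {I : Set} → (I → Carrier) → Carrier
    ⋁-upper : ∀ {I} (h : I → Carrier) (i : I) → h i ≤ ⋁ h
    ⋁-least : ∀ {I} (h : I → Carrier) {a} → (∀ i → h i ≤ a) → ⋁ h ≤ a
    _∧_ : Carrier → Carrier → Carrier
    ∧-lowerˡ : ∀ a b → a ∧ b ≤ a
    ∧-lowerʳ : ∀ a b → a ∧ b ≤ b
    ∧-greatest : ∀ {a b c} → c ≤ a → c ≤ b → c ≤ a ∧ b
    _∨_ : Carrier → Carrier → Carrier
    ∨-upperˡ : ∀ a b → a ≤ a ∨ b
    ∨-upperʳ : ∀ a b → b ≤ a ∨ b
    ∨-least : ∀ {a b c} → a ≤ c → b ≤ c → a ∨ b ≤ c
    𝟎 : Carrier
    𝟏 : Carrier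
    𝟎-least : ∀ a → 𝟎 ≤ a
    𝟏-greatest : ∀ a → a ≤ 𝟏
    _⊗_ : Carrier → Carrier → Carrier
    ⊗-comm : ∀ a b → a ⊗ b ≡ b ⊗ a
    ⊗-assoc : ∀ a b c → (a ⊗ b) ⊗ c ≡ a ⊗ (b ⊗ c)
    ⊗-identityˡ : ∀ a → 𝟏 ⊗ a ≡ a
    _⇒_ : Carrier → Carrier → Carrier
    adj→ : ∀ {a b c} → a ⊗ b ≤ c → a ≤ b ⇒ c
    adj← : ∀ {a b c} → a ≤ b ⇒ c → a ⊗ b ≤ c

module _ (𝐋 : CompleteResiduatedLattice) where
  open CompleteResiduatedLattice 𝐋

  LSet : Set → Set
  LSet X = X → Carrier

  S : {X : Set} → LSet X → LSet X → Carrier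
  S A B = ⋀ (λ x → A x ⇒ B x)

  _∘ʳ_ : {X : Set} → (X → X → Carrier) → LSet X → LSet X
  (R ∘ʳ B) x = ⋁ (λ y → R x y ⊗ B y)

  _ʳ∘_ : {X : Set} → LSet X → (X → X → Carrier) → LSet X
  (A ʳ∘ R) y = ⋁ (λ x → A x ⊗ R x y)

  Power : {X : Set} → (X → X → Carrier) → LSet X → LSet X → Carrier
  Power R A B = S (λ x → A x) (R ∘ʳ B) ∧ S B (A ʳ∘ R)

  record IsLEquality {X : Set} (E : X → X → Carrier) : Set where
    field
      refl : ∀ x → E x x ≡ 𝟏
      sym : ∀ x y → E x y ≡ E y x
      trans : ∀ x y z → E x y ⊗ E y z ≤ E x z
      separated : ∀ x y → E x y ≡ 𝟏 → x ≡ y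

  record LOrderedSet : Set₁ where
    field
      U : Set
      _≈_ : U → U → Carrier
      isLEquality : IsLEquality _≈_
      _≼_ : U → U → Carrier
      ≼-refl : ∀ u → (u ≼ u) ≡ 𝟏
      ≼-trans : ∀ u v w → (u ≼ v) ⊗ (v ≼ w) ≤ (u ≼ w)
      ≼-compat : ∀ u v u′ v′ → (u ≼ v) ⊗ (u ≈ u′) ⊗ (v ≈ v′) ≤ (u′ ≼ v′)
      ≼-antisym : ∀ u v → (u ≼ v) ∧ (v ≼ u) ≤ (u ≈ v)

  module _ (𝐔 : LOrderedSet) where
    open LOrderedSet 𝐔

    𝓛 : LSet U → LSet U
    𝓛 V v = ⋀ (λ u → V u ⇒ (v ≼ u))

    𝓤 : LSet U → LSet U
    𝓤 V v = ⋀ (λ u → V u ⇒ (u ≼ v))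

    IsInf : LSet U → U → Set
    IsInf V u = (𝓛 V u ≡ 𝟏) × (𝓤 (𝓛 V) u ≡ 𝟏)

    IsSup : LSet U → U → Set
    IsSup V u = (𝓤 V u ≡ 𝟏) × (𝓛 (𝓤 V) u ≡ 𝟏)

    record CompletelyLattice : Set where
      field
        inf-exists : (V : LSet U) → Σ U (IsInf V)
        sup-exists : (V : LSet U) → Σ U (IsSup V)

      inf : LSet U → U
      inf V = proj₁ (inf-exists V)

      sup : LSet U → U
      sup V = proj₁ (sup-exists V)

    module _ (cl : CompletelyLattice) where
      open CompletelyLattice cl

      record IsCompleteRelation (R : U → U → Carrier) : Set where
        field
          compat : ∀ u v u′ v′ → R u v ⊗ (u ≈ u′) ⊗ (v ≈ v′) ≤ R u′ v′
          inf-pres : ∀ (V₁ V₂ : LSet U) → Power R V₁ V₂ ≤ R (inf V₁) (inf V₂)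
          sup-pres : ∀ (V₁ V₂ : LSet U) → Power R V₁ V₂ ≤ R (sup V₁) (sup V₂)

      record IsLTolerance (R : U → U → Carrier) : Set where
        field
          reflexive : ∀ u → R u u ≡ 𝟏
          symmetric : ∀ u v → R u v ≡ R v u

      record IsCompleteLTolerance (R : U → U → Carrier) : Set where
        field
          isTolerance : IsLTolerance R
          isComplete : IsCompleteRelation R

      -- class [u]_∼, and u_∼ = inf [u]_∼, u^∼ = sup [u]_∼
      [_]_ : U → (U → U → Carrier) → LSet U
      ([ u ] R) v = R u v

      lowerOf : (U → U → Carrier) → U → U
      lowerOf R u = inf ([ u ] R)

      upperOf : (U → U → Carrier) → U → U
      upperOf R u = sup ([ u ] R)

    IsIsotoneGalois : (U → U) → (U → U) → Set
    IsIsotoneGalois f g = ∀ u v → (f u ≼ v) ≡ (u ≼ g v)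

    IsExtensive : (U → U) → (U → U) → Set
    IsExtensive f g = (∀ u → (f u ≼ u) ≡ 𝟏) × (∀ u → (u ≼ g u) ≡ 𝟏)

    tolFG : (U → U) → (U → U) → U → U → Carrier
    tolFG f g u v = (f u ≼ v) ∧ (v ≼ g u)

-- With the Galois identity (f u ≼ v) = (u ≼ g v), the class [u] of the tolerance
-- is the L-interval between f u and g u. Extensivity makes f u ≤ g u crisp, so f u
-- belongs to [u] to degree 1 and is below all of it: it is the least element, hence
-- the infimum; dually g u is the supremum. For completeness, the power relation
-- relates every element of V₂ to some element of V₁, so by isotony of f and g one gets
-- f (inf V₁) ≼ inf V₂ and sup V₂ ≼ g (sup V₁); the power relation of a symmetric
-- relation is symmetric, which yields the two remaining inequalities.
module Submission where

open import Defs
open import Data.Product using (_×_; _,_; proj₁; proj₂)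
open import Relation.Binary.PropositionalEquality using (_≡_; subst; sym; trans; cong)

module ResiduatedLatticeProperties (𝐋 : CompleteResiduatedLattice) where
  open CompleteResiduatedLattice 𝐋

  ≡⇒≤ : ∀ {a b} → a ≡ b → a ≤ b
  ≡⇒≤ {a} a≡b = subst (a ≤_) a≡b ≤-refl

  ≡𝟏⇒𝟏≤ : ∀ {a} → a ≡ 𝟏 → 𝟏 ≤ a
  ≡𝟏⇒𝟏≤ a≡𝟏 = ≡⇒≤ (sym a≡𝟏)

  𝟏≤⇒≡𝟏 : ∀ {a} → 𝟏 ≤ a → a ≡ 𝟏
  𝟏≤⇒≡𝟏 = ≤-antisym (𝟏-greatest _)

  ⊗-monoˡ : ∀ {a b c} → a ≤ b → a ⊗ c ≤ b ⊗ c
  ⊗-monoˡ a≤b = adj← (≤-trans a≤b (adj→ ≤-refl))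

  ⊗-monoʳ : ∀ {a b c} → a ≤ b → c ⊗ a ≤ c ⊗ b
  ⊗-monoʳ {a} {b} {c} a≤b =
    ≤-trans (≡⇒≤ (⊗-comm c a)) (≤-trans (⊗-monoˡ a≤b) (≡⇒≤ (⊗-comm b c)))

  ⊗-mono : ∀ {a b c d} → a ≤ b → c ≤ d → a ⊗ c ≤ b ⊗ d
  ⊗-mono a≤b c≤d = ≤-trans (⊗-monoˡ a≤b) (⊗-monoʳ c≤d)

  ⊗-crispˡ : ∀ {a b} → 𝟏 ≤ a → b ≤ a ⊗ b
  ⊗-crispˡ {b = b} 𝟏≤a = ≤-trans (≡⇒≤ (sym (⊗-identityˡ b))) (⊗-monoˡ 𝟏≤a)

  ⋁-mono : ∀ {I} {h k : I → Carrier} → (∀ i → h i ≤ k i) → ⋁ h ≤ ⋁ k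
  ⋁-mono {k = k} h≤k = ⋁-least _ (λ i → ≤-trans (h≤k i) (⋁-upper k i))

  S-elim : ∀ {X} {A B : LSet 𝐋 X} x → S 𝐋 A B ⊗ A x ≤ B x
  S-elim x = adj← (⋀-lower _ x)

  S-intro : ∀ {X} {A B : LSet 𝐋 X} {a} → (∀ x → a ⊗ A x ≤ B x) → a ≤ S 𝐋 A B
  S-intro a⊗A≤B = ⋀-greatest _ (λ x → adj→ (a⊗A≤B x))

  S-monoʳ : ∀ {X} {A B C : LSet 𝐋 X} → (∀ x → B x ≤ C x) → S 𝐋 A B ≤ S 𝐋 A C
  S-monoʳ B≤C = S-intro (λ x → ≤-trans (S-elim x) (B≤C x))

  S≡𝟏⇒≤ : ∀ {X} {A B : LSet 𝐋 X} → S 𝐋 A B ≡ 𝟏 → ∀ x → A x ≤ B x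
  S≡𝟏⇒≤ {A = A} S≡𝟏 x =
    ≤-trans (≡⇒≤ (sym (⊗-identityˡ (A x))))
      (≤-trans (⊗-monoˡ (≡𝟏⇒𝟏≤ S≡𝟏)) (S-elim x))

  ≤⇒S≡𝟏 : ∀ {X} {A B : LSet 𝐋 X} → (∀ x → A x ≤ B x) → S 𝐋 A B ≡ 𝟏
  ≤⇒S≡𝟏 A≤B = 𝟏≤⇒≡𝟏 (S-intro (λ x → ≤-trans (≡⇒≤ (⊗-identityˡ _)) (A≤B x)))

module PowerRelationProperties (𝐋 : CompleteResiduatedLattice) {X : Set}
    (R : X → X → CompleteResiduatedLattice.Carrier 𝐋) where
  open CompleteResiduatedLattice 𝐋
  open ResiduatedLatticeProperties 𝐋

  Power-elimʳ : ∀ {A B : LSet 𝐋 X} {y c} → (∀ x → A x ⊗ R x y ≤ c) →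
                Power 𝐋 R A B ⊗ B y ≤ c
  Power-elimʳ {y = y} A⊗R≤c =
    ≤-trans (⊗-monoˡ (∧-lowerʳ _ _)) (≤-trans (S-elim y) (⋁-least _ A⊗R≤c))

  module _ (R-sym : ∀ x y → R x y ≡ R y x) where

    ∘ʳ≤ʳ∘ : ∀ (B : LSet 𝐋 X) x → (_∘ʳ_ 𝐋 R B) x ≤ (_ʳ∘_ 𝐋 B R) x
    ∘ʳ≤ʳ∘ B x = ⋁-mono (λ y →
      ≤-trans (≡⇒≤ (⊗-comm (R x y) (B y))) (⊗-monoʳ (≡⇒≤ (R-sym x y))))

    ʳ∘≤∘ʳ : ∀ (A : LSet 𝐋 X) y → (_ʳ∘_ 𝐋 A R) y ≤ (_∘ʳ_ 𝐋 R A) y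
    ʳ∘≤∘ʳ A y = ⋁-mono (λ x →
      ≤-trans (≡⇒≤ (⊗-comm (A x) (R x y))) (⊗-monoˡ (≡⇒≤ (R-sym x y))))

    Power-sym : ∀ (A B : LSet 𝐋 X) → Power 𝐋 R A B ≤ Power 𝐋 R B A
    Power-sym A B = ∧-greatest
      (≤-trans (∧-lowerʳ _ _) (S-monoʳ (ʳ∘≤∘ʳ A)))
      (≤-trans (∧-lowerˡ _ _) (S-monoʳ (∘ʳ≤ʳ∘ B)))

module LOrderedSetProperties (𝐋 : CompleteResiduatedLattice) (𝐔 : LOrderedSet 𝐋) where
  open CompleteResiduatedLattice 𝐋
  open LOrderedSet 𝐔
  open IsLEquality isLEquality renaming (refl to ≈-refl; sym to ≈-sym)
  open ResiduatedLatticeProperties 𝐋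

  ≼-refl-crisp : ∀ u → 𝟏 ≤ u ≼ u
  ≼-refl-crisp u = ≡𝟏⇒𝟏≤ (≼-refl u)

  ≈⇒≼ : ∀ x y → x ≈ y ≤ x ≼ y
  ≈⇒≼ x y = ≤-trans (⊗-crispˡ (≼-refl-crisp x))
    (≤-trans (⊗-monoʳ (⊗-crispˡ (≡𝟏⇒𝟏≤ (≈-refl x)))) (≼-compat x x x y))

  ≈⇒≽ : ∀ x y → x ≈ y ≤ y ≼ x
  ≈⇒≽ x y = ≤-trans (≡⇒≤ (≈-sym x y)) (≈⇒≼ y x)

  ≼-trans₃ : ∀ a b c d → (a ≼ b) ⊗ (b ≼ c) ⊗ (c ≼ d) ≤ a ≼ d
  ≼-trans₃ a b c d = ≤-trans (⊗-monoʳ (≼-trans b c d)) (≼-trans a b d)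

  ≼-trans-crisp : ∀ {a b c} → (a ≼ b) ≡ 𝟏 → (b ≼ c) ≡ 𝟏 → (a ≼ c) ≡ 𝟏
  ≼-trans-crisp {a} {b} {c} a≼b b≼c = 𝟏≤⇒≡𝟏
    (≤-trans (⊗-crispˡ (≡𝟏⇒𝟏≤ a≼b)) (≤-trans (⊗-monoʳ (≡𝟏⇒𝟏≤ b≼c)) (≼-trans a b c)))

  module _ {W : LSet 𝐋 U} {x : U} where

    IsInf⇒lower : IsInf 𝐋 𝐔 W x → ∀ y → W y ≤ x ≼ y
    IsInf⇒lower (lower , _) = S≡𝟏⇒≤ lower

    IsInf⇒greatest : IsInf 𝐋 𝐔 W x → ∀ y → 𝓛 𝐋 𝐔 W y ≤ y ≼ x
    IsInf⇒greatest (_ , greatest) = S≡𝟏⇒≤ greatest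

    IsSup⇒upper : IsSup 𝐋 𝐔 W x → ∀ y → W y ≤ y ≼ x
    IsSup⇒upper (upper , _) = S≡𝟏⇒≤ upper

    IsSup⇒least : IsSup 𝐋 𝐔 W x → ∀ y → 𝓤 𝐋 𝐔 W y ≤ x ≼ y
    IsSup⇒least (_ , least) = S≡𝟏⇒≤ least

    least⇒IsInf : W x ≡ 𝟏 → (∀ y → W y ≤ x ≼ y) → IsInf 𝐋 𝐔 W x
    least⇒IsInf Wx≡𝟏 lower = ≤⇒S≡𝟏 lower , ≤⇒S≡𝟏 (λ y →
      ≤-trans (⊗-crispˡ (≡𝟏⇒𝟏≤ Wx≡𝟏)) (≤-trans (≡⇒≤ (⊗-comm _ _)) (S-elim x)))

    greatest⇒IsSup : W x ≡ 𝟏 → (∀ y → W y ≤ y ≼ x) → IsSup 𝐋 𝐔 W x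
    greatest⇒IsSup Wx≡𝟏 upper = ≤⇒S≡𝟏 upper , ≤⇒S≡𝟏 (λ y →
      ≤-trans (⊗-crispˡ (≡𝟏⇒𝟏≤ Wx≡𝟏)) (≤-trans (≡⇒≤ (⊗-comm _ _)) (S-elim x)))

  IsInf-unique : ∀ {W x y} → IsInf 𝐋 𝐔 W x → IsInf 𝐋 𝐔 W y → x ≡ y
  IsInf-unique {x = x} {y} x-inf y-inf = separated x y (𝟏≤⇒≡𝟏 (≤-trans
    (∧-greatest
      (≤-trans (≡𝟏⇒𝟏≤ (proj₁ x-inf)) (IsInf⇒greatest y-inf x))
      (≤-trans (≡𝟏⇒𝟏≤ (proj₁ y-inf)) (IsInf⇒greatest x-inf y)))
    (≼-antisym x y)))

  IsSup-unique : ∀ {W x y} → IsSup 𝐋 𝐔 W x → IsSup 𝐋 𝐔 W y → x ≡ y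
  IsSup-unique {x = x} {y} x-sup y-sup = separated x y (𝟏≤⇒≡𝟏 (≤-trans
    (∧-greatest
      (≤-trans (≡𝟏⇒𝟏≤ (proj₁ y-sup)) (IsSup⇒least x-sup y))
      (≤-trans (≡𝟏⇒𝟏≤ (proj₁ x-sup)) (IsSup⇒least y-sup x)))
    (≼-antisym x y)))

  module _ (cl : CompletelyLattice 𝐋 𝐔) where
    open CompletelyLattice cl

    inf-IsInf : ∀ W → IsInf 𝐋 𝐔 W (inf W)
    inf-IsInf W = proj₂ (inf-exists W)

    sup-IsSup : ∀ W → IsSup 𝐋 𝐔 W (sup W)
    sup-IsSup W = proj₂ (sup-exists W)

    IsInf⇒≡inf : ∀ {W x} → IsInf 𝐋 𝐔 W x → inf W ≡ x
    IsInf⇒≡inf {W} = IsInf-unique (inf-IsInf W)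

    IsSup⇒≡sup : ∀ {W x} → IsSup 𝐋 𝐔 W x → sup W ≡ x
    IsSup⇒≡sup {W} = IsSup-unique (sup-IsSup W)

module GaloisToleranceProperties (𝐋 : CompleteResiduatedLattice) (𝐔 : LOrderedSet 𝐋)
    {f g : LOrderedSet.U 𝐔 → LOrderedSet.U 𝐔} (galois : IsIsotoneGalois 𝐋 𝐔 f g) where
  open CompleteResiduatedLattice 𝐋
  open LOrderedSet 𝐔
  open ResiduatedLatticeProperties 𝐋
  open LOrderedSetProperties 𝐋 𝐔

  _∼_ : U → U → Carrier
  _∼_ = tolFG 𝐋 𝐔 f g

  galois→ : ∀ {u v} → f u ≼ v ≤ u ≼ g v
  galois→ = ≡⇒≤ (galois _ _)

  galois← : ∀ {u v} → u ≼ g v ≤ f u ≼ v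
  galois← = ≡⇒≤ (sym (galois _ _))

  f-isotone : ∀ x y → x ≼ y ≤ f x ≼ f y
  f-isotone x y = ≤-trans (⊗-crispˡ (≤-trans (≼-refl-crisp (f y)) galois→))
    (≤-trans (≡⇒≤ (⊗-comm _ _)) (≤-trans (≼-trans _ _ _) galois←))

  g-isotone : ∀ x y → x ≼ y ≤ g x ≼ g y
  g-isotone x y = ≤-trans (⊗-crispˡ (≤-trans (≼-refl-crisp (g x)) galois←))
    (≤-trans (≼-trans _ _ _) galois→)

  ∼-sym≤ : ∀ u v → u ∼ v ≤ v ∼ u
  ∼-sym≤ u v = ∧-greatest (≤-trans (∧-lowerʳ _ _) galois←) (≤-trans (∧-lowerˡ _ _) galois→)

  ∼-sym : ∀ u v → u ∼ v ≡ v ∼ u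
  ∼-sym u v = ≤-antisym (∼-sym≤ u v) (∼-sym≤ v u)

  ∼-compat : ∀ u v u′ v′ → (u ∼ v) ⊗ (u ≈ u′) ⊗ (v ≈ v′) ≤ u′ ∼ v′
  -- The chains are f u′ ≼ f u ≼ v ≼ v′ and v′ ≼ v ≼ g u ≼ g u′.
  ∼-compat u v u′ v′ = ∧-greatest
    (≤-trans (⊗-mono (∧-lowerˡ _ _) (⊗-mono (≈⇒≽ u u′) (≈⇒≼ v v′)))
      (≤-trans swap₁₂ (≤-trans (⊗-monoˡ (f-isotone u′ u)) (≼-trans₃ _ _ _ _))))
    (≤-trans (⊗-mono (∧-lowerʳ _ _) (⊗-mono (≈⇒≼ u u′) (≈⇒≽ v v′)))
      (≤-trans rotate (≤-trans (⊗-monoʳ (⊗-monoʳ (g-isotone u u′))) (≼-trans₃ _ _ _ _))))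
    where
    swap₁₂ : ∀ {a b c} → a ⊗ b ⊗ c ≤ b ⊗ a ⊗ c
    swap₁₂ {a} {b} {c} = ≡⇒≤ (trans (sym (⊗-assoc a b c))
      (trans (cong (_⊗ c) (⊗-comm a b)) (⊗-assoc b a c)))
    rotate : ∀ {a b c} → a ⊗ b ⊗ c ≤ c ⊗ a ⊗ b
    rotate {a} {b} {c} = ≡⇒≤ (trans (sym (⊗-assoc a b c)) (⊗-comm (a ⊗ b) c))

  module _ (extensive : IsExtensive 𝐋 𝐔 f g) where

    f≼g-crisp : ∀ u → (f u ≼ g u) ≡ 𝟏
    f≼g-crisp u = ≼-trans-crisp (proj₁ extensive u) (proj₂ extensive u)

    ∼-refl : ∀ u → u ∼ u ≡ 𝟏
    ∼-refl u = 𝟏≤⇒≡𝟏 (∧-greatest (≡𝟏⇒𝟏≤ (proj₁ extensive u)) (≡𝟏⇒𝟏≤ (proj₂ extensive u)))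

    f-IsInf-class : ∀ u → IsInf 𝐋 𝐔 (u ∼_) (f u)
    f-IsInf-class u = least⇒IsInf
      (𝟏≤⇒≡𝟏 (∧-greatest (≼-refl-crisp (f u)) (≡𝟏⇒𝟏≤ (f≼g-crisp u))))
      (λ v → ∧-lowerˡ _ _)

    g-IsSup-class : ∀ u → IsSup 𝐋 𝐔 (u ∼_) (g u)
    g-IsSup-class u = greatest⇒IsSup
      (𝟏≤⇒≡𝟏 (∧-greatest (≡𝟏⇒𝟏≤ (f≼g-crisp u)) (≼-refl-crisp (g u))))
      (λ v → ∧-lowerʳ _ _)

  module _ (cl : CompletelyLattice 𝐋 𝐔) where
    open CompletelyLattice cl
    open PowerRelationProperties 𝐋 _∼_

    f-inf-≼-inf : ∀ V₁ V₂ → Power 𝐋 _∼_ V₁ V₂ ≤ f (inf V₁) ≼ inf V₂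
    f-inf-≼-inf V₁ V₂ = ≤-trans
      (S-intro (λ v → Power-elimʳ (λ x → ≤-trans
        (⊗-mono (≤-trans (IsInf⇒lower (inf-IsInf cl V₁) x) (f-isotone _ x)) (∧-lowerˡ _ _))
        (≼-trans _ _ _))))
      (IsInf⇒greatest (inf-IsInf cl V₂) _)

    sup-≼-g-sup : ∀ V₁ V₂ → Power 𝐋 _∼_ V₁ V₂ ≤ sup V₂ ≼ g (sup V₁)
    sup-≼-g-sup V₁ V₂ = ≤-trans
      (S-intro (λ v → Power-elimʳ (λ x → ≤-trans (≡⇒≤ (⊗-comm _ _)) (≤-trans
        (⊗-mono (∧-lowerʳ _ _) (≤-trans (IsSup⇒upper (sup-IsSup cl V₁) x) (g-isotone x _)))
        (≼-trans _ _ _)))))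
      (IsSup⇒least (sup-IsSup cl V₂) _)

    ∼-complete : IsCompleteRelation 𝐋 𝐔 cl _∼_
    ∼-complete = record
      { compat = ∼-compat
      ; inf-pres = λ V₁ V₂ → ∧-greatest (f-inf-≼-inf V₁ V₂)
          (≤-trans (Power-sym ∼-sym V₁ V₂) (≤-trans (f-inf-≼-inf V₂ V₁) galois→))
      ; sup-pres = λ V₁ V₂ → ∧-greatest
          (≤-trans (Power-sym ∼-sym V₁ V₂) (≤-trans (sup-≼-g-sup V₂ V₁) galois←))
          (sup-≼-g-sup V₁ V₂)
      }

theorem14 : (𝐋 : CompleteResiduatedLattice) (𝐔 : LOrderedSet 𝐋)
    (cl : CompletelyLattice 𝐋 𝐔) (f g : LOrderedSet.U 𝐔 → LOrderedSet.U 𝐔) →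
    IsIsotoneGalois 𝐋 𝐔 f g → IsExtensive 𝐋 𝐔 f g →
    IsCompleteLTolerance 𝐋 𝐔 cl (tolFG 𝐋 𝐔 f g)
    × (∀ u → (lowerOf 𝐋 𝐔 cl (tolFG 𝐋 𝐔 f g) u ≡ f u)
    × (upperOf 𝐋 𝐔 cl (tolFG 𝐋 𝐔 f g) u ≡ g u))
theorem14 𝐋 𝐔 cl f g galois extensive =
  record
    { isTolerance = record { reflexive = ∼-refl extensive ; symmetric = ∼-sym }
    ; isComplete = ∼-complete cl
    }
  , λ u → IsInf⇒≡inf cl (f-IsInf-class extensive u) , IsSup⇒≡sup cl (g-IsSup-class extensive u)
  where
  open GaloisToleranceProperties 𝐋 𝐔 galois
  open LOrderedSetProperties 𝐋 𝐔
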